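{- Let $G$ and $H$ be connected graphs and let $R\subseteq V(G\,\square\,H)$. If $\pi_G(R)$ is a general position set of $G$ and $|\pi_G(R)|=|R|$, then $R$ is a general position set of $G\,\square\,H$.
   Context: A general position set of a graph $G$ is a set $S\subseteq V(G)$ such that no three vertices of $S$ lie on a common shortest path of $G$. The Cartesian product $G\,\square\,H$ has vertex set $V(G)\times V(H)$, with $(g_1,h_1)$ adjacent to $(g_2,h_2)$ iff either $g_1g_2\in E(G)$ and $h_1=h_2$, or $g_1=g_2$ and $h_1h_2\in E(H)$. For $S\subseteq V(G\,\square\,H)$, $\pi_G(S)=\{g\in V(G): (g,h)\in S \text{ for some } h\in V(H)\}$. -}

module Defs where

open import Data.Nat using (ℕ; suc; _≤_)
open import Data.Fin using (Fin)
open import Data.Fin.Properties using (_≟_)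
open import Data.List using (List; []; _∷_; length; map; deduplicate)
open import Data.List.Membership.Propositional using (_∈_)
open import Data.Product using (_×_; _,_; proj₁; ∃)
open import Data.Sum using (_⊎_)
open import Relation.Nullary using (¬_)
open import Relation.Binary.PropositionalEquality using (_≡_; _≢_)

record Graph : Set₁ where
  field
    n      : ℕ
    Adj    : Fin n → Fin n → Set
    sym    : ∀ {x y} → Adj x y → Adj y x
    irrefl : ∀ {x} → ¬ Adj x x
  V : Set
  V = Fin n

open Graph public

data Walk {V : Set} (E : V → V → Set) : V → V → Set where
  [_] : (x : V) → Walk E x x
  _∷_ : ∀ {x y z} → E x y → Walk E y z → Walk E x z

wlength : ∀ {V : Set} {E : V → V → Set} {u v : V} → Walk E u v → ℕ
wlength [ _ ] = 0
wlength (_ ∷ w) = suc (wlength w)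

vertices : ∀ {V : Set} {E : V → V → Set} {u v : V} → Walk E u v → List V
vertices [ x ] = x ∷ []
vertices {u = u} (_ ∷ w) = u ∷ vertices w

IsShortest : ∀ {V : Set} {E : V → V → Set} {u v : V} → Walk E u v → Set
IsShortest {E = E} {u} {v} w = ∀ (w' : Walk E u v) → wlength w ≤ wlength w'

Connected : Graph → Set
Connected G = ∀ (u v : V G) → Walk (Adj G) u v

GeneralPosition : ∀ {V : Set} (E : V → V → Set) → List V → Set
GeneralPosition {V} E S =
  ∀ {x y z : V} → x ∈ S → y ∈ S → z ∈ S → x ≢ y → y ≢ z → x ≢ z →
  ∀ {u v : V} (P : Walk E u v) → IsShortest P →
  ¬ (x ∈ vertices P × y ∈ vertices P × z ∈ vertices P)

□Adj : (G H : Graph) → V G × V H → V G × V H → Set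
□Adj G H (g₁ , h₁) (g₂ , h₂) =
  (Adj G g₁ g₂ × h₁ ≡ h₂) ⊎ (g₁ ≡ g₂ × Adj H h₁ h₂)

πG : (G H : Graph) → List (V G × V H) → List (V G)
πG G H R = deduplicate _≟_ (map proj₁ R)

{-# OPTIONS --safe #-}
-- Projecting a walk of G □ H onto G keeps its G-steps and drops its H-steps, so its
-- length splits as (G-part) + (H-part). Any G-walk W between the same endpoints can
-- be recombined with the H-part into a walk of length |W| + (H-part); hence the
-- projection of a shortest walk is a shortest walk of G, and it visits the projections
-- of all vertices of the original walk. The cardinality hypothesis makes π_G injective
-- on R, so three distinct vertices of R on a shortest walk of G □ H would project to
-- three distinct vertices of π_G(R) on a shortest walk of G.
module Submission where

open import Defs hiding (sym)
open import Data.Nat using (suc; _+_; _<_)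
open import Data.Nat.Properties using (≤-antisym; ≤-trans; ≤-reflexive; <⇒≢; <-≤-trans; suc-injective; +-suc; +-cancelʳ-≤; module ≤-Reasoning)
open import Data.Fin.Properties using (_≟_)
open import Data.List using (List; []; _∷_; length; map; filter; deduplicate)
open import Data.List.Properties using (length-filter; filter-notAll; length-deduplicate; length-map)
open import Data.List.Membership.Propositional using (_∈_; _∉_)
open import Data.List.Membership.Propositional.Properties using (∈-deduplicate⁺; ∈-map⁺)
open import Data.List.Relation.Unary.Any using (here; there)
import Data.List.Relation.Unary.Any as Any
open import Data.List.Relation.Unary.All using (_∷_; lookup)
open import Data.List.Relation.Unary.All.Properties using (¬Any⇒All¬; map⁻)
open import Data.List.Relation.Unary.Unique.Propositional using (Unique; []; _∷_)
open import Data.Product using (_×_; _,_; proj₁; proj₂)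
open import Data.Sum using (inj₁; inj₂)
open import Data.Empty using (⊥-elim)
open import Function using (_∘_)
open import Relation.Nullary using (¬?)
open import Relation.Binary.Definitions using (DecidableEquality)
open import Relation.Binary.PropositionalEquality using (_≡_; _≢_; refl; sym; trans; cong; cong₂)
open import Relation.Binary.PropositionalEquality.Properties using (module ≡-Reasoning)

module _ {A : Set} (_≟ᴬ_ : DecidableEquality A) where

  deduplicate-length≡⇒Unique : ∀ xs → length (deduplicate _≟ᴬ_ xs) ≡ length xs → Unique xs
  deduplicate-length≡⇒Unique [] _ = []
  deduplicate-length≡⇒Unique (x ∷ xs) eq =
    ¬Any⇒All¬ xs x∉xs ∷ deduplicate-length≡⇒Unique xs dedup-length≡
    where
    keepsAll : length (filter (¬? ∘ (x ≟ᴬ_)) (deduplicate _≟ᴬ_ xs)) ≡ length xs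
    keepsAll = suc-injective eq

    dedup-length≡ : length (deduplicate _≟ᴬ_ xs) ≡ length xs
    dedup-length≡ = ≤-antisym (length-deduplicate _≟ᴬ_ xs)
      (≤-trans (≤-reflexive (sym keepsAll)) (length-filter (¬? ∘ (x ≟ᴬ_)) (deduplicate _≟ᴬ_ xs)))

    x∉xs : x ∉ xs
    x∉xs x∈xs = <⇒≢ (<-≤-trans dropsOne (length-deduplicate _≟ᴬ_ xs)) keepsAll
      where
      dropsOne : length (filter (¬? ∘ (x ≟ᴬ_)) (deduplicate _≟ᴬ_ xs)) < length (deduplicate _≟ᴬ_ xs)
      dropsOne = filter-notAll (¬? ∘ (x ≟ᴬ_)) (deduplicate _≟ᴬ_ xs)
        (Any.map (λ x≡y x≢y → x≢y x≡y) (∈-deduplicate⁺ _≟ᴬ_ x∈xs))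

Unique-map⇒injectiveOn : ∀ {A B : Set} (f : A → B) {xs : List A} → Unique (map f xs) →
  ∀ {x y} → x ∈ xs → y ∈ xs → f x ≡ f y → x ≡ y
Unique-map⇒injectiveOn f _ (here refl) (here refl) _ = refl
Unique-map⇒injectiveOn f (fx∉ ∷ _) (here refl) (there y∈) fx≡fy = ⊥-elim (lookup (map⁻ fx∉) y∈ fx≡fy)
Unique-map⇒injectiveOn f (fy∉ ∷ _) (there x∈) (here refl) fx≡fy = ⊥-elim (lookup (map⁻ fy∉) x∈ (sym fx≡fy))
Unique-map⇒injectiveOn f (_ ∷ u) (there x∈) (there y∈) fx≡fy = Unique-map⇒injectiveOn f u x∈ y∈ fx≡fy

module _ {V : Set} {E : V → V → Set} where

  _++ʷ_ : ∀ {x y z} → Walk E x y → Walk E y z → Walk E x z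
  [ _ ] ++ʷ w′ = w′
  (e ∷ w) ++ʷ w′ = e ∷ (w ++ʷ w′)

  wlength-++ʷ : ∀ {x y z} (w : Walk E x y) (w′ : Walk E y z) →
    wlength (w ++ʷ w′) ≡ wlength w + wlength w′
  wlength-++ʷ [ _ ] w′ = refl
  wlength-++ʷ (e ∷ w) w′ = cong suc (wlength-++ʷ w w′)

  start∈vertices : ∀ {u v} (w : Walk E u v) → u ∈ vertices w
  start∈vertices [ _ ] = here refl
  start∈vertices (_ ∷ _) = here refl

module _ (G H : Graph) where

  projectG : ∀ {x z} → Walk (□Adj G H) x z → Walk (Adj G) (proj₁ x) (proj₁ z)
  projectG [ x ] = [ proj₁ x ]
  projectG (inj₁ (e , _) ∷ w) = e ∷ projectG w
  projectG (inj₂ (refl , _) ∷ w) = projectG w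

  projectH : ∀ {x z} → Walk (□Adj G H) x z → Walk (Adj H) (proj₂ x) (proj₂ z)
  projectH [ x ] = [ proj₂ x ]
  projectH (inj₁ (_ , refl) ∷ w) = projectH w
  projectH (inj₂ (_ , e) ∷ w) = e ∷ projectH w

  wlength-project : ∀ {x z} (w : Walk (□Adj G H) x z) →
    wlength w ≡ wlength (projectG w) + wlength (projectH w)
  wlength-project [ _ ] = refl
  wlength-project (inj₁ (_ , refl) ∷ w) = cong suc (wlength-project w)
  wlength-project (inj₂ (refl , _) ∷ w) =
    trans (cong suc (wlength-project w)) (sym (+-suc (wlength (projectG w)) (wlength (projectH w))))

  liftG : ∀ {g g′} (h : V H) → Walk (Adj G) g g′ → Walk (□Adj G H) (g , h) (g′ , h)
  liftG h [ g ] = [ (g , h) ]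
  liftG h (e ∷ w) = inj₁ (e , refl) ∷ liftG h w

  liftH : ∀ {h h′} (g : V G) → Walk (Adj H) h h′ → Walk (□Adj G H) (g , h) (g , h′)
  liftH g [ h ] = [ (g , h) ]
  liftH g (e ∷ w) = inj₂ (refl , e) ∷ liftH g w

  wlength-liftG : ∀ {g g′} (h : V H) (w : Walk (Adj G) g g′) → wlength (liftG h w) ≡ wlength w
  wlength-liftG h [ _ ] = refl
  wlength-liftG h (e ∷ w) = cong suc (wlength-liftG h w)

  wlength-liftH : ∀ {h h′} (g : V G) (w : Walk (Adj H) h h′) → wlength (liftH g w) ≡ wlength w
  wlength-liftH g [ _ ] = refl
  wlength-liftH g (e ∷ w) = cong suc (wlength-liftH g w)

  combine : ∀ {g g′ h h′} → Walk (Adj G) g g′ → Walk (Adj H) h h′ → Walk (□Adj G H) (g , h) (g′ , h′)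
  combine {g′ = g′} {h = h} wG wH = liftG h wG ++ʷ liftH g′ wH

  wlength-combine : ∀ {g g′ h h′} (wG : Walk (Adj G) g g′) (wH : Walk (Adj H) h h′) →
    wlength (combine wG wH) ≡ wlength wG + wlength wH
  wlength-combine {g′ = g′} {h = h} wG wH = begin
    wlength (liftG h wG ++ʷ liftH g′ wH)             ≡⟨ wlength-++ʷ (liftG h wG) (liftH g′ wH) ⟩
    wlength (liftG h wG) + wlength (liftH g′ wH)     ≡⟨ cong₂ _+_ (wlength-liftG h wG) (wlength-liftH g′ wH) ⟩
    wlength wG + wlength wH                          ∎
    where open ≡-Reasoning

  projectG-shortest : ∀ {x z} (P : Walk (□Adj G H) x z) → IsShortest P → IsShortest (projectG P)
  projectG-shortest P P-shortest W = +-cancelʳ-≤ (wlength (projectH P)) _ _ (begin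
    wlength (projectG P) + wlength (projectH P)  ≡⟨ wlength-project P ⟨
    wlength P                                    ≤⟨ P-shortest (combine W (projectH P)) ⟩
    wlength (combine W (projectH P))             ≡⟨ wlength-combine W (projectH P) ⟩
    wlength W + wlength (projectH P)             ∎)
    where open ≤-Reasoning

  ∈-projectG : ∀ {x z y} (P : Walk (□Adj G H) x z) → y ∈ vertices P → proj₁ y ∈ vertices (projectG P)
  ∈-projectG [ _ ] (here refl) = here refl
  ∈-projectG (inj₁ _ ∷ w) (here refl) = here refl
  ∈-projectG (inj₁ _ ∷ w) (there y∈) = there (∈-projectG w y∈)
  ∈-projectG (inj₂ (refl , _) ∷ w) (here refl) = start∈vertices (projectG w)
  ∈-projectG (inj₂ (refl , _) ∷ w) (there y∈) = ∈-projectG w y∈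

lemma3p3 : (G H : Graph) → Connected G → Connected H →
    (R : List (V G × V H)) → Unique R →
    GeneralPosition (Adj G) (πG G H R) →
    length (πG G H R) ≡ length R →
    GeneralPosition (□Adj G H) R
lemma3p3 G H _ _ R _ πR-general πR-length x∈ y∈ z∈ x≢y y≢z x≢z P P-shortest (x∈P , y∈P , z∈P) =
  πR-general (∈πR x∈) (∈πR y∈) (∈πR z∈) (distinct x∈ y∈ x≢y) (distinct y∈ z∈ y≢z) (distinct x∈ z∈ x≢z)
    (projectG G H P) (projectG-shortest G H P P-shortest)
    (∈-projectG G H P x∈P , ∈-projectG G H P y∈P , ∈-projectG G H P z∈P)
  where
  ∈πR : ∀ {x} → x ∈ R → proj₁ x ∈ πG G H R
  ∈πR = ∈-deduplicate⁺ _≟_ ∘ ∈-map⁺ proj₁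

  proj₁-unique : Unique (map proj₁ R)
  proj₁-unique = deduplicate-length≡⇒Unique _≟_ (map proj₁ R) (trans πR-length (sym (length-map proj₁ R)))

  distinct : ∀ {x y} → x ∈ R → y ∈ R → x ≢ y → proj₁ x ≢ proj₁ y
  distinct x∈ y∈ x≢y = x≢y ∘ Unique-map⇒injectiveOn proj₁ proj₁-unique x∈ y∈
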